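{- For infinitely many positive integers $n$ with $n \equiv 0 \pmod 4$, and also for infinitely many positive integers $n$ with $n \equiv 2 \pmod 4$, there is an odd cover of the complete graph $K_n$ by $\frac{n}{2}$ complete bipartite graphs.
   Context: An odd cover of $K_n$ by complete bipartite graphs is a family $G_1,\dots,G_r$ of complete bipartite graphs, each on some subset of the vertex set of $K_n$ (given by two disjoint colour classes $A,B$, whose edges are all pairs with one end in $A$ and one in $B$), such that every edge of $K_n$ is an edge of an odd number of the $G_i$. -}

module Defs where

open import Data.Nat using (ℕ; zero; suc; _+_; _*_)
open import Data.Nat using (_%_)
open import Data.Fin using (Fin)
import Data.Fin as Fin
open import Data.Bool using (Bool; true; false; _∧_; _∨_; not; T)
open import Data.Product using (Σ; ∃; _×_; _,_)
open import Relation.Binary.PropositionalEquality using (_≡_)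
open import Relation.Nullary using (¬_)

record CompleteBipartite (n : ℕ) : Set where
  field
    A : Fin n → Bool
    B : Fin n → Bool
    disjoint : ∀ v → ¬ (T (A v) × T (B v))
    A-nonempty : ∃ λ v → T (A v)
    B-nonempty : ∃ λ v → T (B v)

open CompleteBipartite public

hasEdge : ∀ {n} → CompleteBipartite n → Fin n → Fin n → Bool
hasEdge G u v = (A G u ∧ B G v) ∨ (B G u ∧ A G v)

count : (r : ℕ) → (Fin r → Bool) → ℕ
count zero P = 0
count (suc r) P with P Fin.zero
... | true  = suc (count r (λ i → P (Fin.suc i)))
... | false = count r (λ i → P (Fin.suc i))

IsOddCover : (n r : ℕ) → (Fin r → CompleteBipartite n) → Set
IsOddCover n r G = ∀ (u v : Fin n) → ¬ (u ≡ v) → count r (λ i → hasEdge (G i) u v) % 2 ≡ 1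

HasOddCover : (n r : ℕ) → Set
HasOddCover n r = Σ (Fin r → CompleteBipartite n) (IsOddCover n r)

module Submission where

-- Index vertices by the nonzero vectors of 𝔽₃ᵏ (there are 3ᵏ − 1 of them) and the
-- graphs by the lines of the dual space, choosing one nonzero form f per line; the
-- graph of f has colour classes f = 1 and f = 2.  It contains the edge {v, w} iff
-- {f v, f w} = {1, 2}, and over 𝔽₂ this indicator equals [f v ≠ 0] + [f w ≠ 0] + [f v ≠ f w].
-- Summed over all lines, [f x ≠ f y] gives 3ᵏ⁻¹ ≡ 1 if x ≠ y and 0 otherwise, so every
-- edge is covered 1 + 1 + 1 ≡ 1 times.  There are (3ᵏ − 1)/2 graphs, and 3ᵏ − 1 is
-- 0 or 2 mod 4 according as k is even or odd.

open import Defs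
open import Data.Nat using (ℕ; _≤_; _<_; _%_; _/_)
open import Data.Product using (∃; _×_)
open import Relation.Binary.PropositionalEquality using (_≡_)

open import Algebra.Bundles using (Monoid; CommutativeRing)
open import Data.Bool using (Bool; true; false; not; _∧_; _∨_; _xor_; if_then_else_; T)
import Data.Bool as Bool
open import Data.Bool.Properties using (xor-∧-commutativeRing)
open import Data.Fin using (Fin; suc; toℕ; fromℕ<; combine; remQuot; punchIn; punchOut; _↑ˡ_; _↑ʳ_; _≟_)
open import Data.Fin.Patterns using (0F; 1F; 2F)
open import Data.Fin.Properties using (all?; remQuot-combine; punchIn-injective; punchInᵢ≢i; punchIn-punchOut)
open import Data.Nat using (suc; _+_; _*_; _^_; z≤n; s≤s)
open import Data.Nat.DivMod using (m%n<n; %-distribˡ-+; [m+kn]%n≡m%n; m*n/n≡m)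
open import Data.Nat.Properties using (≤-trans; m≤m+n; m≤m*n; m≤n*m; n≤1+n)
open import Data.Nat.Tactic.RingSolver using (solve-∀)
open import Data.Product using (_,_)
open import Data.Vec using (Vec; []; _∷_; replicate)
open import Data.Vec.Properties using (≡-dec)
open import Data.Vec.Recursive using (Fin[m^n]↔Fin[m]^n)
open import Data.Vec.Recursive.Properties using (↔Vec)
open import Function.Base using (_∘_)
open import Function.Bundles using (Inverse; _↔_)
open import Function.Properties.Inverse using (↔-trans)
open import Relation.Binary.PropositionalEquality using (_≢_; refl; sym; trans; cong; cong₂; subst; module ≡-Reasoning)
open import Relation.Nullary using (¬_)
open import Relation.Nullary.Decidable using (does; from-yes; dec-false)

module MonoidSum {a ℓ} (M : Monoid a ℓ) where
  open Monoid M using (Carrier; _≈_; _∙_; ∙-congˡ; assoc; identityˡ; setoid)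
    renaming (sym to ≈-sym; refl to ≈-refl)
  open import Algebra.Properties.Monoid.Sum M using (sum; sum-syntax)
  open import Relation.Binary.Reasoning.Setoid setoid

  sum-↑ : ∀ m {n} (f : Fin (m + n) → Carrier) →
          sum f ≈ sum (λ i → f (i ↑ˡ n)) ∙ sum (λ j → f (m ↑ʳ j))
  sum-↑ 0       f = ≈-sym (identityˡ _)
  sum-↑ (suc m) {n} f = begin
    f 0F ∙ sum (λ i → f (suc i))
      ≈⟨ ∙-congˡ (sum-↑ m (λ i → f (suc i))) ⟩
    f 0F ∙ (sum (λ i → f (suc (i ↑ˡ n))) ∙ sum (λ j → f (suc m ↑ʳ j)))
      ≈⟨ assoc _ _ _ ⟨
    (f 0F ∙ sum (λ i → f (suc (i ↑ˡ n)))) ∙ sum (λ j → f (suc m ↑ʳ j)) ∎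

  sum-combine : ∀ m {n} (f : Fin (m * n) → Carrier) →
                sum f ≈ ∑[ c < m ] ∑[ i < n ] f (combine c i)
  sum-combine 0       f = ≈-refl
  sum-combine (suc m) {n} f = begin
    sum f
      ≈⟨ sum-↑ n f ⟩
    sum (λ i → f (i ↑ˡ (m * n))) ∙ sum (λ j → f (n ↑ʳ j))
      ≈⟨ ∙-congˡ (sum-combine m (λ j → f (n ↑ʳ j))) ⟩
    sum (λ i → f (i ↑ˡ (m * n))) ∙ ∑[ c < m ] ∑[ i < n ] f (combine (suc c) i) ∎

-- Sums of Booleans are taken in (Bool, xor): ∑ computes parities.
open CommutativeRing xor-∧-commutativeRing using (semiring; +-monoid)
open import Algebra.Properties.Semiring.Sum semiring
  using (sum; sum-syntax; sum-cong-≗; ∑-comm; ∑-distrib-+; *-distribˡ-sum)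
open MonoidSum +-monoid using (sum-combine)

bit : Bool → ℕ
bit b = if b then 1 else 0

suc-%2 : ∀ x b → x % 2 ≡ bit b → suc x % 2 ≡ bit (not b)
suc-%2 x b eq = trans (%-distribˡ-+ 1 x 2) (trans (cong (λ y → (1 + y) % 2) eq) (lemma b))
  where
  lemma : ∀ b → (1 + bit b) % 2 ≡ bit (not b)
  lemma true  = refl
  lemma false = refl

count-%2 : ∀ r P → count r P % 2 ≡ bit (∑[ i < r ] P i)
count-%2 0       P = refl
count-%2 (suc r) P with P 0F
... | true  = suc-%2 (count r (λ i → P (suc i))) _ (count-%2 r (λ i → P (suc i)))
... | false = count-%2 r (λ i → P (suc i))

module Punctured {a} {A : Set a} {n} (ι : Fin (suc n) ↔ A) (a₀ : A) where
  open Inverse ι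

  punctured : Fin n → A
  punctured u = to (punchIn (from a₀) u)

  private
    from-punctured : ∀ u → from (punctured u) ≡ punchIn (from a₀) u
    from-punctured u = strictlyInverseʳ _

  punctured-injective : ∀ {u v} → punctured u ≡ punctured v → u ≡ v
  punctured-injective {u} {v} eq = punchIn-injective (from a₀) u v
    (trans (sym (from-punctured u)) (trans (cong from eq) (from-punctured v)))

  punctured-≢ : ∀ u → punctured u ≢ a₀
  punctured-≢ u eq = punchInᵢ≢i (from a₀) u (trans (sym (from-punctured u)) (cong from eq))

  punctured-onto : ∀ {x} → x ≢ a₀ → ∃ λ u → punctured u ≡ x
  punctured-onto {x} x≢a₀ = punchOut from-a₀≢from-x ,
    trans (cong to (punchIn-punchOut from-a₀≢from-x)) (strictlyInverseˡ x)
    where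
    from-a₀≢from-x : from a₀ ≢ from x
    from-a₀≢from-x eq =
      x≢a₀ (trans (sym (strictlyInverseˡ x)) (trans (cong to (sym eq)) (strictlyInverseˡ a₀)))

𝔽₃ : Set
𝔽₃ = Fin 3

infixl 6 _+₃_
infixl 7 _·₃_

_+₃_ : 𝔽₃ → 𝔽₃ → 𝔽₃
x +₃ y = fromℕ< (m%n<n (toℕ x + toℕ y) 3)

_·₃_ : 𝔽₃ → 𝔽₃ → 𝔽₃
x ·₃ y = fromℕ< (m%n<n (toℕ x * toℕ y) 3)

+₃-·₃-zeroʳ : ∀ x c → x +₃ c ·₃ 0F ≡ x
+₃-·₃-zeroʳ = from-yes (all? λ x → all? λ c → x +₃ c ·₃ 0F ≟ x)

_≠₃_ : 𝔽₃ → 𝔽₃ → Bool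
x ≠₃ y = not (does (x ≟ y))

fibre : (𝔽₃ → 𝔽₃ → Bool) → 𝔽₃ → 𝔽₃ → 𝔽₃ → 𝔽₃ → Bool
fibre P t s a b = ∑[ c < 3 ] P (a +₃ c ·₃ t) (b +₃ c ·₃ s)

-- If t ≠ s, then a − b + c (t − s) vanishes for exactly one c ∈ 𝔽₃, so the other two terms cancel.
fibre-≠₃ : ∀ t s a b → fibre _≠₃_ t s a b ≡ does (t ≟ s) ∧ (a ≠₃ b)
fibre-≠₃ = from-yes (all? λ t → all? λ s → all? λ a → all? λ b →
  fibre _≠₃_ t s a b Bool.≟ does (t ≟ s) ∧ (a ≠₃ b))

lines : ℕ → ℕ
lines 0       = 0
lines (suc k) = suc (3 * lines k)

1+lines*2≡3^ : ∀ k → suc (lines k * 2) ≡ 3 ^ k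
1+lines*2≡3^ 0       = refl
1+lines*2≡3^ (suc k) = trans (lemma (lines k)) (cong (3 *_) (1+lines*2≡3^ k))
  where
  lemma : ∀ x → suc (suc (3 * x) * 2) ≡ 3 * suc (x * 2)
  lemma = solve-∀

-- The forms, one nonzero form per line of the dual of 𝔽₃ᵏ, evaluated on t ∷ v are
-- t itself and fᵢ v + c·t for every c ∈ 𝔽₃ and every form fᵢ in dimension k.
form : ∀ {k} → Fin (lines k) → Vec 𝔽₃ k → 𝔽₃
extendedForm : ∀ {k} → 𝔽₃ × Fin (lines k) → Vec 𝔽₃ (suc k) → 𝔽₃

form {suc k} 0F      (t ∷ v) = t
form {suc k} (suc j) v       = extendedForm (remQuot {3} (lines k) j) v

extendedForm (c , i) (t ∷ v) = form i v +₃ c ·₃ t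

_≠ᵥ_ : ∀ {k} → Vec 𝔽₃ k → Vec 𝔽₃ k → Bool
v ≠ᵥ w = not (does (≡-dec _≟_ v w))

zeros : ∀ k → Vec 𝔽₃ k
zeros k = replicate k 0F

≠ᵥ-true : ∀ {k} {v w : Vec 𝔽₃ k} → v ≢ w → v ≠ᵥ w ≡ true
≠ᵥ-true {v = v} {w} v≢w = cong not (dec-false (≡-dec _≟_ v w) v≢w)

form-zeros : ∀ {k} (i : Fin (lines k)) → form i (zeros k) ≡ 0F
form-zeros {suc k} 0F      = refl
form-zeros {suc k} (suc j) = extendedForm-zeros (remQuot {3} (lines k) j)
  where
  extendedForm-zeros : ∀ q → extendedForm q (zeros (suc k)) ≡ 0F
  extendedForm-zeros (c , i) = trans (cong (_+₃ c ·₃ 0F) (form-zeros i)) (+₃-·₃-zeroʳ 0F c)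

form-surjective : ∀ {k} (i : Fin (lines k)) c → ∃ λ v → form i v ≡ c
form-surjective {suc k} 0F      c = c ∷ zeros k , refl
form-surjective {suc k} (suc j) c = extendedForm-surjective (remQuot {3} (lines k) j)
  where
  extendedForm-surjective : ∀ q → ∃ λ v → extendedForm q v ≡ c
  extendedForm-surjective (c′ , i) with form-surjective i c
  ... | v , eq = 0F ∷ v , trans (+₃-·₃-zeroʳ _ c′) eq

sum-forms-suc : ∀ {k} (P : 𝔽₃ → 𝔽₃ → Bool) t s (v w : Vec 𝔽₃ k) →
  ∑[ i < lines (suc k) ] P (form i (t ∷ v)) (form i (s ∷ w))
    ≡ P t s xor ∑[ i < lines k ] fibre P t s (form i v) (form i w)
sum-forms-suc {k} P t s v w = cong (P t s xor_) (begin
  ∑[ j < 3 * lines k ] Q (remQuot (lines k) j)    ≡⟨ sum-combine 3 {lines k} _ ⟩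
  ∑[ c < 3 ] ∑[ i < lines k ] Q (remQuot (lines k) (combine c i))
    ≡⟨ sum-cong-≗ (λ c → sum-cong-≗ (λ i → cong Q (remQuot-combine c i))) ⟩
  ∑[ c < 3 ] ∑[ i < lines k ] Q (c , i)            ≡⟨ ∑-comm (λ c i → Q (c , i)) ⟩
  ∑[ i < lines k ] fibre P t s (form i v) (form i w) ∎)
  where
  open ≡-Reasoning
  Q : 𝔽₃ × Fin (lines k) → Bool
  Q q = P (extendedForm q (t ∷ v)) (extendedForm q (s ∷ w))

not-xor-∧-not : ∀ a b → not a xor (a ∧ not b) ≡ not (a ∧ b)
not-xor-∧-not true  b = refl
not-xor-∧-not false b = refl

∑-form-≠₃ : ∀ {k} (v w : Vec 𝔽₃ k) → ∑[ i < lines k ] (form i v ≠₃ form i w) ≡ v ≠ᵥ w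
∑-form-≠₃ []      []      = refl
∑-form-≠₃ {suc k} (t ∷ v) (s ∷ w) = begin
  ∑[ i < lines (suc k) ] (form i (t ∷ v) ≠₃ form i (s ∷ w))
    ≡⟨ sum-forms-suc _≠₃_ t s v w ⟩
  (t ≠₃ s) xor ∑[ i < lines k ] fibre _≠₃_ t s (form i v) (form i w)
    ≡⟨ cong ((t ≠₃ s) xor_) (sum-cong-≗ (λ i → fibre-≠₃ t s (form i v) (form i w))) ⟩
  (t ≠₃ s) xor ∑[ i < lines k ] (does (t ≟ s) ∧ (form i v ≠₃ form i w))
    ≡⟨ cong ((t ≠₃ s) xor_) (sym (*-distribˡ-sum (does (t ≟ s)) (λ i → form i v ≠₃ form i w))) ⟩
  (t ≠₃ s) xor (does (t ≟ s) ∧ ∑[ i < lines k ] (form i v ≠₃ form i w))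
    ≡⟨ cong (λ d → (t ≠₃ s) xor (does (t ≟ s) ∧ d)) (∑-form-≠₃ v w) ⟩
  (t ≠₃ s) xor (does (t ≟ s) ∧ (v ≠ᵥ w))
    ≡⟨ not-xor-∧-not (does (t ≟ s)) (does (≡-dec _≟_ v w)) ⟩
  (t ∷ v) ≠ᵥ (s ∷ w) ∎
  where open ≡-Reasoning

opposite : 𝔽₃ → 𝔽₃ → Bool
opposite x y = (does (x ≟ 1F) ∧ does (y ≟ 2F)) ∨ (does (x ≟ 2F) ∧ does (y ≟ 1F))

opposite-≠₃ : ∀ x y → opposite x y ≡ (x ≠₃ 0F) xor (y ≠₃ 0F) xor (x ≠₃ y)
opposite-≠₃ = from-yes (all? λ x → all? λ y →
  opposite x y Bool.≟ (x ≠₃ 0F) xor (y ≠₃ 0F) xor (x ≠₃ y))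

∑-form-opposite : ∀ {k} (v w : Vec 𝔽₃ k) →
  ∑[ i < lines k ] opposite (form i v) (form i w) ≡ (v ≠ᵥ zeros k) xor (w ≠ᵥ zeros k) xor (v ≠ᵥ w)
∑-form-opposite {k} v w = begin
  ∑[ i < lines k ] opposite (form i v) (form i w)
    ≡⟨ sum-cong-≗ (λ i → opposite-≠₃ (form i v) (form i w)) ⟩
  ∑[ i < lines k ] ((form i v ≠₃ 0F) xor (form i w ≠₃ 0F) xor (form i v ≠₃ form i w))
    ≡⟨ ∑-distrib-+ (λ i → form i v ≠₃ 0F) _ ⟩
  ∑[ i < lines k ] (form i v ≠₃ 0F) xor ∑[ i < lines k ] ((form i w ≠₃ 0F) xor (form i v ≠₃ form i w))
    ≡⟨ cong₂ _xor_ (∑-form-≠₃-zeros v) (∑-distrib-+ (λ i → form i w ≠₃ 0F) _) ⟩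
  (v ≠ᵥ zeros k) xor ∑[ i < lines k ] (form i w ≠₃ 0F) xor ∑[ i < lines k ] (form i v ≠₃ form i w)
    ≡⟨ cong ((v ≠ᵥ zeros k) xor_) (cong₂ _xor_ (∑-form-≠₃-zeros w) (∑-form-≠₃ v w)) ⟩
  (v ≠ᵥ zeros k) xor (w ≠ᵥ zeros k) xor (v ≠ᵥ w) ∎
  where
  open ≡-Reasoning
  ∑-form-≠₃-zeros : ∀ u → ∑[ i < lines k ] (form i u ≠₃ 0F) ≡ u ≠ᵥ zeros k
  ∑-form-≠₃-zeros u =
    trans (sum-cong-≗ (λ i → cong (form i u ≠₃_) (sym (form-zeros i)))) (∑-form-≠₃ u (zeros k))

module FormCover (k : ℕ) where
  vectors : Fin (suc (lines k * 2)) ↔ Vec 𝔽₃ k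
  vectors = subst (λ m → Fin m ↔ Vec 𝔽₃ k) (sym (1+lines*2≡3^ k))
                  (↔-trans (Fin[m^n]↔Fin[m]^n 3 k) (↔Vec k))

  open Punctured vectors (zeros k) renaming (punctured to vertex)

  form-vertex-onto : ∀ i c → c ≢ 0F → ∃ λ u → form i (vertex u) ≡ c
  form-vertex-onto i c c≢0 with form-surjective i c
  ... | v , fv≡c with punctured-onto {v} (λ v≡0 →
                        c≢0 (trans (sym fv≡c) (trans (cong (form i) v≡0) (form-zeros i))))
  ...   | u , u↦v = u , trans (cong (form i) u↦v) fv≡c

  graph : Fin (lines k) → CompleteBipartite (lines k * 2)
  A (graph i) u = does (form i (vertex u) ≟ 1F)
  B (graph i) u = does (form i (vertex u) ≟ 2F)
  disjoint (graph i) u = classes-disjoint (form i (vertex u))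
    where
    classes-disjoint : ∀ x → ¬ (T (does (x ≟ 1F)) × T (does (x ≟ 2F)))
    classes-disjoint 0F (() , _)
    classes-disjoint 1F (_ , ())
    classes-disjoint 2F (() , _)
  A-nonempty (graph i) with form-vertex-onto i 1F (λ ())
  ... | u , eq = u , subst (λ x → T (does (x ≟ 1F))) (sym eq) _
  B-nonempty (graph i) with form-vertex-onto i 2F (λ ())
  ... | u , eq = u , subst (λ x → T (does (x ≟ 2F))) (sym eq) _

  oddCover : HasOddCover (lines k * 2) (lines k)
  oddCover = graph , λ u v u≢v → begin
    count (lines k) (λ i → hasEdge (graph i) u v) % 2
      ≡⟨ count-%2 (lines k) _ ⟩
    bit (∑[ i < lines k ] opposite (form i (vertex u)) (form i (vertex v)))
      ≡⟨ cong bit (∑-form-opposite (vertex u) (vertex v)) ⟩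
    bit ((vertex u ≠ᵥ zeros k) xor (vertex v ≠ᵥ zeros k) xor (vertex u ≠ᵥ vertex v))
      ≡⟨ cong bit (cong₂ _xor_ (≠ᵥ-true (punctured-≢ u))
                  (cong₂ _xor_ (≠ᵥ-true (punctured-≢ v)) (≠ᵥ-true (u≢v ∘ punctured-injective)))) ⟩
    1 ∎
    where open ≡-Reasoning

k≤lines : ∀ k → k ≤ lines k
k≤lines 0       = z≤n
k≤lines (suc k) = s≤s (≤-trans (k≤lines k) (m≤n*m (lines k) 3))

lines*2%4-periodic : ∀ j r → lines (j * 2 + r) * 2 % 4 ≡ lines r * 2 % 4
lines*2%4-periodic 0       r = refl
lines*2%4-periodic (suc j) r = begin
  lines (suc j * 2 + r) * 2 % 4      ≡⟨ cong (_% 4) (lemma l) ⟩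
  (l * 2 + (2 + 4 * l) * 4) % 4      ≡⟨ [m+kn]%n≡m%n (l * 2) (2 + 4 * l) 4 ⟩
  l * 2 % 4                          ≡⟨ lines*2%4-periodic j r ⟩
  lines r * 2 % 4                    ∎
  where
  open ≡-Reasoning
  l = lines (j * 2 + r)
  lemma : ∀ x → suc (3 * suc (3 * x)) * 2 ≡ x * 2 + (2 + 4 * x) * 4
  lemma = solve-∀

oddCoverBeyond : ∀ m r → ∃ λ n → m ≤ n × 0 < n × n % 4 ≡ lines r * 2 % 4 × HasOddCover n (n / 2)
oddCoverBeyond m r = lines k * 2 , ≤-trans (n≤1+n m) 1+m≤n , ≤-trans (s≤s z≤n) 1+m≤n ,
  lines*2%4-periodic (suc m) r ,
  subst (HasOddCover (lines k * 2)) (sym (m*n/n≡m (lines k) 2)) (FormCover.oddCover k)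
  where
  k = suc m * 2 + r
  1+m≤n : suc m ≤ lines k * 2
  1+m≤n = ≤-trans (m≤m*n (suc m) 2)
         (≤-trans (m≤m+n _ r) (≤-trans (k≤lines k) (m≤m*n (lines k) 2)))

mainTheorem1 : (∀ m → ∃ λ n → m ≤ n × 0 < n × n % 4 ≡ 0 × HasOddCover n (n / 2))
               × (∀ m → ∃ λ n → m ≤ n × 0 < n × n % 4 ≡ 2 × HasOddCover n (n / 2))
mainTheorem1 = (λ m → oddCoverBeyond m 0) , (λ m → oddCoverBeyond m 1)
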